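{- Let $\mathcal V\subseteq\mathbb F_2^n$ be a subspace of co-dimension $C$ and let $\mathcal W$ be a subspace with $\mathcal W\oplus\mathcal V^\perp=\mathbb F_2^n$. Then there exists a set $S\subseteq\mathcal W$ of size at least $n-C$ such that for every $u\in S$, $|(u+\mathcal V^\perp)^{=1}|\ge1$. Moreover, there exists $S_1\subseteq S$ of size at least $n-2C$ such that for every $u\in S_1$, $|(u+\mathcal V^\perp)^{=1}|=1$.
   Context: $\mathcal V^\perp=\{\gamma:\langle\gamma,v\rangle=0\ \forall v\in\mathcal V\}$; $\mathcal W\oplus\mathcal V^\perp=\mathbb F_2^n$ means $\mathcal W\cap\mathcal V^\perp=\{0\}$ and $\mathcal W+\mathcal V^\perp=\mathbb F_2^n$. For $A\subseteq\mathbb F_2^n$, $A^{=t}=\{u\in A:\|u\|_1=t\}$, $\|u\|_1$ the Hamming weight (so $A^{=1}$ is the set of standard basis vectors in $A$). -}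

module Defs where

open import Data.Bool using (Bool; true; false; _xor_; _∧_; if_then_else_)
open import Data.Nat using (ℕ; _+_)
open import Data.Fin using (Fin)
open import Data.Vec using (Vec; replicate; zipWith; foldr; map)
open import Data.Vec.Functional using () renaming (Vector to FVec)
open import Data.Product using (Σ; ∃; _×_)
open import Relation.Binary.PropositionalEquality using (_≡_)

-- Vectors of 𝔽₂ⁿ, with 𝔽₂ = Bool (false = 0, true = 1, addition = xor, product = ∧).
F2^ : ℕ → Set
F2^ n = Vec Bool n

𝟎 : ∀ {n} → F2^ n
𝟎 = replicate _ false

infixl 6 _⊕_
_⊕_ : ∀ {n} → F2^ n → F2^ n → F2^ n
_⊕_ = zipWith _xor_

_·_ : ∀ {n} → Bool → F2^ n → F2^ n
c · v = map (c ∧_) v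

⟨_,_⟩ : ∀ {n} → F2^ n → F2^ n → Bool
⟨ x , y ⟩ = foldr _ _xor_ false (zipWith _∧_ x y)

weight : ∀ {n} → F2^ n → ℕ
weight = foldr _ (λ b k → (if b then 1 else 0) + k) 0

Subset : ℕ → Set
Subset n = F2^ n → Bool

_∈ₛ_ : ∀ {n} → F2^ n → Subset n → Set
x ∈ₛ A = A x ≡ true

IsSubspace : ∀ {n} → Subset n → Set
IsSubspace A = (𝟎 ∈ₛ A) × (∀ x y → x ∈ₛ A → y ∈ₛ A → (x ⊕ y) ∈ₛ A)

lincomb : ∀ {n d} → Vec Bool d → Vec (F2^ n) d → F2^ n
lincomb c B = foldr _ _⊕_ 𝟎 (zipWith _·_ c B)

LinIndep : ∀ {n d} → Vec (F2^ n) d → Set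
LinIndep {d = d} B = ∀ c → lincomb c B ≡ 𝟎 → c ≡ replicate d false

IsBasis : ∀ {n d} → Subset n → Vec (F2^ n) d → Set
IsBasis A B = LinIndep B × (∀ v → v ∈ₛ A → ∃ λ c → lincomb c B ≡ v)
                        × (∀ c → lincomb c B ∈ₛ A)

HasDim : ∀ {n} → Subset n → ℕ → Set
HasDim {n} A d = IsSubspace A × Σ (Vec (F2^ n) d) (IsBasis A)

_∈⊥_ : ∀ {n} → F2^ n → Subset n → Set
γ ∈⊥ V = ∀ v → v ∈ₛ V → ⟨ γ , v ⟩ ≡ false

_∈_+⊥_ : ∀ {n} → F2^ n → F2^ n → Subset n → Set
x ∈ u +⊥ V = ∃ λ γ → γ ∈⊥ V × x ≡ u ⊕ γ

DirectSumPerp : ∀ {n} → Subset n → Subset n → Set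
DirectSumPerp W V =
  (∀ x → x ∈ₛ W → x ∈⊥ V → x ≡ 𝟎) ×
  (∀ x → ∃ λ w → ∃ λ γ → w ∈ₛ W × γ ∈⊥ V × x ≡ w ⊕ γ)

AtLeastOneWt1 : ∀ {n} → Subset n → F2^ n → Set
AtLeastOneWt1 V u = ∃ λ x → x ∈ u +⊥ V × weight x ≡ 1

ExactlyOneWt1 : ∀ {n} → Subset n → F2^ n → Set
ExactlyOneWt1 V u = ∃ λ x → (x ∈ u +⊥ V × weight x ≡ 1) ×
  (∀ y → y ∈ u +⊥ V → weight y ≡ 1 → y ≡ x)

-- Let b₁,…,b_d (d = n − C) be a basis of 𝒱 and call fᵢ = (b₁ᵢ,…,b_dᵢ) ∈ 𝔽₂^d the
-- i-th column.  Split every unit vector as eᵢ = wᵢ + γᵢ with wᵢ ∈ 𝒲, γᵢ ∈ 𝒱^⊥.  Two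
-- vectors of one coset of 𝒱^⊥ differ by an element of 𝒱^⊥, and eᵢ + eⱼ ∈ 𝒱^⊥ forces
-- fᵢ = fⱼ; so distinct columns give distinct wᵢ, and a weight-one vector eⱼ of the
-- coset wᵢ + 𝒱^⊥ has fⱼ = fᵢ.  Pick one coordinate per distinct column (the set R)
-- and let Q ⊆ R be those whose column occurs only once; take S = w(R), S₁ = w(Q).
-- Independence of the bᵢ makes c ↦ (⟨c, f_r⟩)_{r ∈ R} injective on 𝔽₂^d, whence
-- |R| ≥ d = n − C; every column outside Q occurs twice, whence 2|R| ≤ n + |Q| and
-- |Q| ≥ n − 2C.
module Submission where

open import Defs
open import Algebra.Bundles using (CommutativeRing)
open import Data.Bool using (Bool; true; false; _xor_; _∧_)
open import Data.Bool.Properties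
  using (xor-assoc; xor-comm; xor-identityˡ; xor-identityʳ; xor-same; ∧-distribʳ-xor; xor-∧-commutativeRing)
open import Algebra.Properties.CommutativeSemigroup
  (CommutativeRing.+-commutativeSemigroup xor-∧-commutativeRing) using () renaming (interchange to xor-interchange)
open import Data.Fin using (Fin; zero; suc; combine; remQuot)
open import Data.Fin.Properties using (2↔Bool; remQuot-combine; combine-remQuot; injective⇒≤)
open import Data.List using (List; []; _∷_; length; map; filter; allFin)
open import Data.List.Properties using (length-map; length-filter; filter-notAll; length-tabulate)
open import Data.List.Relation.Unary.All as All using (All; []; _∷_)
import Data.List.Relation.Unary.All.Properties as All
open import Data.List.Relation.Unary.Any as Any using (Any; here; there; any?)
open import Data.List.Relation.Unary.AllPairs as AllPairs using (AllPairs; []; _∷_)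
import Data.List.Relation.Unary.AllPairs.Properties as AllPairs
open import Data.List.Relation.Unary.Unique.Propositional using (Unique)
open import Data.List.Membership.Propositional using (_∈_; lose)
open import Data.List.Membership.Propositional.Properties using (∈-filter⁺; ∈-filter⁻; ∈-map⁺; ∈-allFin)
open import Data.Nat using (ℕ; zero; suc; _+_; _*_; _^_; _∸_; _≤_; z≤n; s≤s)
open import Data.Nat.Properties
open import Data.Product using (Σ; ∃; _×_; _,_; proj₁; proj₂)
open import Data.Vec using (Vec; []; _∷_; lookup; fromList)
import Data.Vec as Vec
open import Data.Vec.Properties
  using (zipWith-assoc; zipWith-comm; zipWith-identityˡ; zipWith-identityʳ; ∷-injectiveˡ; ∷-injectiveʳ;
         ≡-dec; lookup-zipWith; lookup-map; lookup-replicate; map-id; tabulate∘lookup; tabulate-cong)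
open import Function using (id; _∘_; Injective; _↔_; _↣_; mk↣; mk↔ₛ′)
open import Function.Properties.Inverse using (↔⇒↣; ↔-sym)
open import Function.Construct.Composition using (_↣-∘_)
open import Function.Bundles using (Injection; Inverse)
open import Relation.Binary.Definitions using (DecidableEquality)
open import Relation.Binary.PropositionalEquality
open import Relation.Nullary using (¬_; yes; no; ¬?; contradiction)
open import Relation.Unary using (Decidable)

private
  variable
    n d m : ℕ

⊕-assoc : (x y z : F2^ n) → (x ⊕ y) ⊕ z ≡ x ⊕ (y ⊕ z)
⊕-assoc = zipWith-assoc xor-assoc

⊕-comm : (x y : F2^ n) → x ⊕ y ≡ y ⊕ x
⊕-comm = zipWith-comm xor-comm

⊕-identityˡ : (x : F2^ n) → 𝟎 ⊕ x ≡ x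
⊕-identityˡ = zipWith-identityˡ xor-identityˡ

⊕-identityʳ : (x : F2^ n) → x ⊕ 𝟎 ≡ x
⊕-identityʳ = zipWith-identityʳ xor-identityʳ

⊕-self : (x : F2^ n) → x ⊕ x ≡ 𝟎
⊕-self []      = refl
⊕-self (a ∷ x) = cong₂ _∷_ (xor-same a) (⊕-self x)

⊕-cancelˡ : (w x y : F2^ n) → (w ⊕ x) ⊕ (w ⊕ y) ≡ x ⊕ y
⊕-cancelˡ w x y = begin
  (w ⊕ x) ⊕ (w ⊕ y)  ≡⟨ cong (_⊕ (w ⊕ y)) (⊕-comm w x) ⟩
  (x ⊕ w) ⊕ (w ⊕ y)  ≡⟨ ⊕-assoc x w (w ⊕ y) ⟩
  x ⊕ (w ⊕ (w ⊕ y))  ≡⟨ cong (x ⊕_) (sym (⊕-assoc w w y)) ⟩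
  x ⊕ ((w ⊕ w) ⊕ y)  ≡⟨ cong (λ z → x ⊕ (z ⊕ y)) (⊕-self w) ⟩
  x ⊕ (𝟎 ⊕ y)        ≡⟨ cong (x ⊕_) (⊕-identityˡ y) ⟩
  x ⊕ y              ∎
  where open ≡-Reasoning

xor≡false⇒≡ : ∀ {a b} → a xor b ≡ false → a ≡ b
xor≡false⇒≡ {false} {false} _ = refl
xor≡false⇒≡ {true}  {true}  _ = refl

⊕≡𝟎⇒≡ : (x y : F2^ n) → x ⊕ y ≡ 𝟎 → x ≡ y
⊕≡𝟎⇒≡ []      []      _  = refl
⊕≡𝟎⇒≡ (a ∷ x) (b ∷ y) eq = cong₂ _∷_ (xor≡false⇒≡ (∷-injectiveˡ eq)) (⊕≡𝟎⇒≡ x y (∷-injectiveʳ eq))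

Vec-ext : {A : Set} (x y : Vec A n) → (∀ i → lookup x i ≡ lookup y i) → x ≡ y
Vec-ext x y p = trans (sym (tabulate∘lookup x)) (trans (tabulate-cong p) (tabulate∘lookup y))

⟨𝟎,_⟩ : (v : F2^ n) → ⟨ 𝟎 , v ⟩ ≡ false
⟨𝟎, []    ⟩ = refl
⟨𝟎, b ∷ v ⟩ = ⟨𝟎, v ⟩

⟨⟩-distribʳ-⊕ : (x y v : F2^ n) → ⟨ x ⊕ y , v ⟩ ≡ ⟨ x , v ⟩ xor ⟨ y , v ⟩
⟨⟩-distribʳ-⊕ []      []      []      = refl
⟨⟩-distribʳ-⊕ (a ∷ x) (a′ ∷ y) (b ∷ v) = begin
  ((a xor a′) ∧ b) xor ⟨ x ⊕ y , v ⟩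
    ≡⟨ cong₂ _xor_ (∧-distribʳ-xor b a a′) (⟨⟩-distribʳ-⊕ x y v) ⟩
  ((a ∧ b) xor (a′ ∧ b)) xor (⟨ x , v ⟩ xor ⟨ y , v ⟩)
    ≡⟨ xor-interchange (a ∧ b) (a′ ∧ b) ⟨ x , v ⟩ ⟨ y , v ⟩ ⟩
  ((a ∧ b) xor ⟨ x , v ⟩) xor ((a′ ∧ b) xor ⟨ y , v ⟩) ∎
  where open ≡-Reasoning

∈⊥-⊕ : {V : Subset n} {γ γ′ : F2^ n} → γ ∈⊥ V → γ′ ∈⊥ V → (γ ⊕ γ′) ∈⊥ V
∈⊥-⊕ {γ = γ} {γ′} γ⊥ γ′⊥ v v∈V = trans (⟨⟩-distribʳ-⊕ γ γ′ v) (cong₂ _xor_ (γ⊥ v v∈V) (γ′⊥ v v∈V))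

+⊥-difference : {V : Subset n} {u x y : F2^ n} → x ∈ u +⊥ V → y ∈ u +⊥ V → (x ⊕ y) ∈⊥ V
+⊥-difference {V = V} {u} (γ , γ⊥ , refl) (γ′ , γ′⊥ , refl) =
  subst (_∈⊥ V) (sym (⊕-cancelˡ u γ γ′)) (∈⊥-⊕ {γ = γ} {γ′} γ⊥ γ′⊥)

𝐞 : Fin n → F2^ n
𝐞 zero    = true ∷ 𝟎
𝐞 (suc i) = false ∷ 𝐞 i

weight-𝟎 : ∀ n → weight (𝟎 {n}) ≡ 0
weight-𝟎 zero    = refl
weight-𝟎 (suc n) = weight-𝟎 n

weight-𝐞 : (i : Fin n) → weight (𝐞 i) ≡ 1
weight-𝐞 {suc n} zero = cong suc (weight-𝟎 n)
weight-𝐞 (suc i)      = weight-𝐞 i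

weight≡0⇒𝟎 : (y : F2^ n) → weight y ≡ 0 → y ≡ 𝟎
weight≡0⇒𝟎 []          _  = refl
weight≡0⇒𝟎 (false ∷ y) w0 = cong (false ∷_) (weight≡0⇒𝟎 y w0)

weight≡1⇒𝐞 : (y : F2^ n) → weight y ≡ 1 → ∃ λ i → y ≡ 𝐞 i
weight≡1⇒𝐞 (true ∷ y)  w1 = zero , cong (true ∷_) (weight≡0⇒𝟎 y (suc-injective w1))
weight≡1⇒𝐞 (false ∷ y) w1 with i , refl ← weight≡1⇒𝐞 y w1 = suc i , refl

⟨𝐞_,_⟩ : (i : Fin n) (v : F2^ n) → ⟨ 𝐞 i , v ⟩ ≡ lookup v i
⟨𝐞 zero  , b ∷ v ⟩ = trans (cong (b xor_) ⟨𝟎, v ⟩) (xor-identityʳ b)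
⟨𝐞 suc i , b ∷ v ⟩ = ⟨𝐞 i , v ⟩

false·x≡𝟎 : (x : F2^ n) → false · x ≡ 𝟎
false·x≡𝟎 []      = refl
false·x≡𝟎 (_ ∷ x) = cong (false ∷_) (false·x≡𝟎 x)

lincomb-𝟎 : (B : Vec (F2^ n) d) → lincomb 𝟎 B ≡ 𝟎
lincomb-𝟎 []      = refl
lincomb-𝟎 (b ∷ B) = trans (cong₂ _⊕_ (false·x≡𝟎 b) (lincomb-𝟎 B)) (⊕-identityˡ 𝟎)

lincomb-𝐞 : (B : Vec (F2^ n) d) (k : Fin d) → lincomb (𝐞 k) B ≡ lookup B k
lincomb-𝐞 (b ∷ B) zero    = trans (cong₂ _⊕_ (map-id b) (lincomb-𝟎 B)) (⊕-identityʳ b)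
lincomb-𝐞 (b ∷ B) (suc k) = trans (cong₂ _⊕_ (false·x≡𝟎 b) (lincomb-𝐞 B k)) (⊕-identityˡ _)

column : Vec (F2^ n) d → Fin n → F2^ d
column B i = Vec.map (λ b → lookup b i) B

lookup-lincomb : (c : F2^ d) (B : Vec (F2^ n) d) (i : Fin n) → lookup (lincomb c B) i ≡ ⟨ c , column B i ⟩
lookup-lincomb []      []      i = lookup-replicate i false
lookup-lincomb (a ∷ c) (b ∷ B) i = trans (lookup-zipWith _xor_ i (a · b) (lincomb c B))
  (cong₂ _xor_ (lookup-map i (a ∧_) b) (lookup-lincomb c B i))

𝐞⊕𝐞∈⊥⇒column≡ : {V : Subset n} (B : Vec (F2^ n) d) → (∀ c → lincomb c B ∈ₛ V) →
                 ∀ {i j} → (𝐞 i ⊕ 𝐞 j) ∈⊥ V → column B i ≡ column B j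
𝐞⊕𝐞∈⊥⇒column≡ {V = V} B B⊆V {i} {j} ⊥V = Vec-ext (column B i) (column B j) λ k →
  let b = lookup B k
      b∈V : b ∈ₛ V
      b∈V = subst (_∈ₛ V) (lincomb-𝐞 B k) (B⊆V (𝐞 k))
      ⟨𝐞ᵢ⟩≡⟨𝐞ⱼ⟩ = xor≡false⇒≡ (trans (sym (⟨⟩-distribʳ-⊕ (𝐞 i) (𝐞 j) b)) (⊥V b b∈V))
  in begin
    lookup (column B i) k  ≡⟨ lookup-map k (λ b → lookup b i) B ⟩
    lookup b i             ≡⟨ sym ⟨𝐞 i , b ⟩ ⟩
    ⟨ 𝐞 i , b ⟩            ≡⟨ ⟨𝐞ᵢ⟩≡⟨𝐞ⱼ⟩ ⟩
    ⟨ 𝐞 j , b ⟩            ≡⟨ ⟨𝐞 j , b ⟩ ⟩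
    lookup b j             ≡⟨ sym (lookup-map k (λ b → lookup b j) B) ⟩
    lookup (column B j) k  ∎
  where open ≡-Reasoning

Vec-Bool↔Fin : ∀ m → Vec Bool m ↔ Fin (2 ^ m)
Vec-Bool↔Fin k = mk↔ₛ′ encode decode (encode-decode {k}) decode-encode
  where
  open Inverse 2↔Bool
  encode : Vec Bool m → Fin (2 ^ m)
  encode []      = zero
  encode (b ∷ v) = combine (from b) (encode v)
  decode : Fin (2 ^ m) → Vec Bool m
  decode {zero}  _ = []
  decode {suc m} i = to (proj₁ (remQuot (2 ^ m) i)) ∷ decode (proj₂ (remQuot (2 ^ m) i))
  encode-decode : (i : Fin (2 ^ m)) → encode (decode {m} i) ≡ i
  encode-decode {zero}  zero = refl
  encode-decode {suc m} i = trans
    (cong₂ combine (strictlyInverseʳ (proj₁ (remQuot (2 ^ m) i))) (encode-decode {m} (proj₂ (remQuot (2 ^ m) i))))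
    (combine-remQuot (2 ^ m) i)
  decode-encode : (v : Vec Bool m) → decode (encode v) ≡ v
  decode-encode []      = refl
  decode-encode {suc m} (b ∷ v) = cong₂ _∷_
    (trans (cong (to ∘ proj₁) remQuot-encode) (strictlyInverseˡ b))
    (trans (cong (decode ∘ proj₂) remQuot-encode) (decode-encode v))
    where
    remQuot-encode : remQuot (2 ^ m) (encode (b ∷ v)) ≡ (from b , encode v)
    remQuot-encode = remQuot-combine (from b) (encode v)

Vec-Bool-injective⇒≤ : (h : Vec Bool d → Vec Bool m) → Injective _≡_ _≡_ h → d ≤ m
Vec-Bool-injective⇒≤ {d} {m} h h-inj = ≮⇒≥ λ m<d → ≤⇒≯ 2^d≤2^m (^-monoʳ-< 2 (s≤s (s≤s z≤n)) m<d)
  where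
  embedding : Fin (2 ^ d) ↣ Fin (2 ^ m)
  embedding = ↔⇒↣ (Vec-Bool↔Fin m) ↣-∘ (mk↣ h-inj ↣-∘ ↔⇒↣ (↔-sym (Vec-Bool↔Fin d)))
  2^d≤2^m : 2 ^ d ≤ 2 ^ m
  2^d≤2^m = injective⇒≤ (Injection.injective embedding)

2*suc-≤-suc+ : ∀ {r a b q} → 2 * r ≤ a + q → suc a ≤ b → 2 * suc r ≤ suc b + q
2*suc-≤-suc+ {r} {a} {b} {q} 2r≤a+q a<b = begin
  2 * suc r      ≡⟨ *-suc 2 r ⟩
  2 + 2 * r      ≤⟨ +-monoʳ-≤ 2 2r≤a+q ⟩
  2 + (a + q)    ≤⟨ s≤s (+-monoˡ-≤ q a<b) ⟩
  suc b + q      ∎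
  where open ≤-Reasoning

module _ {I A : Set} (_≟_ : DecidableEquality A) (f : I → A) where

  record Classes (xs : List I) : Set where
    field
      reps singles      : List I
      reps⊆             : All (_∈ xs) reps
      singles⊆reps      : All (_∈ reps) singles
      reps-distinct     : AllPairs (λ a b → f a ≢ f b) reps
      singles-distinct  : AllPairs (λ a b → f a ≢ f b) singles
      reps-cover        : ∀ {x} → x ∈ xs → ∃ λ r → r ∈ reps × f r ≡ f x
      singles-alone     : All (λ q → ∀ {z} → z ∈ xs → f z ≡ f q → z ≡ q) singles
      count             : 2 * length reps ≤ length xs + length singles

  private
    differs? : (x : I) → Decidable (λ y → f y ≢ f x)
    differs? x y = ¬? (f y ≟ f x)

  module Extend (x : I) (ys : List I) (c : Classes (filter (differs? x) ys)) where
    open Classes c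

    reps-differ : All (λ r → r ∈ ys × f r ≢ f x) reps
    reps-differ = All.map (∈-filter⁻ (differs? x)) reps⊆

    singles-differ : All (λ r → r ∈ ys × f r ≢ f x) singles
    singles-differ = All.map (All.lookup reps-differ) singles⊆reps

    x-distinct : ∀ {L} → All (λ r → r ∈ ys × f r ≢ f x) L → All (λ r → f x ≢ f r) L
    x-distinct = All.map (λ (_ , fr≢fx) fx≡fr → fr≢fx (sym fx≡fr))

    cover : ∀ {z} → z ∈ x ∷ ys → ∃ λ r → r ∈ x ∷ reps × f r ≡ f z
    cover (here refl) = x , here refl , refl
    cover {z} (there z∈ys) with f z ≟ f x
    ... | yes fz≡fx = x , here refl , sym fz≡fx
    ... | no  fz≢fx with r , r∈ , fr≡fz ← reps-cover (∈-filter⁺ (differs? x) z∈ys fz≢fx) =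
      r , there r∈ , fr≡fz

    alone : All (λ q → ∀ {z} → z ∈ x ∷ ys → f z ≡ f q → z ≡ q) singles
    alone = All.zipWith (λ (sq , (_ , fq≢fx)) → λ where
        (here refl)  fx≡fq → contradiction (sym fx≡fq) fq≢fx
        (there z∈ys) fz≡fq → sq (∈-filter⁺ (differs? x) z∈ys (λ fz≡fx → fq≢fx (trans (sym fz≡fq) fz≡fx))) fz≡fq)
      (singles-alone , singles-differ)

    reps⊆x∷ys : All (_∈ x ∷ ys) (x ∷ reps)
    reps⊆x∷ys = here refl ∷ All.map (there ∘ proj₁) reps-differ

    reps-distinct′ : AllPairs (λ a b → f a ≢ f b) (x ∷ reps)
    reps-distinct′ = x-distinct reps-differ ∷ reps-distinct

    -- x's class has a second member, so x is no single.
    shared : Any (λ y → f y ≡ f x) ys → Classes (x ∷ ys)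
    shared dup = record
      { reps = x ∷ reps ; singles = singles
      ; reps⊆ = reps⊆x∷ys
      ; singles⊆reps = All.map there singles⊆reps
      ; reps-distinct = reps-distinct′
      ; singles-distinct = singles-distinct
      ; reps-cover = cover
      ; singles-alone = alone
      ; count = 2*suc-≤-suc+ count (filter-notAll (differs? x) ys (Any.map (λ fy≡fx fy≢fx → fy≢fx fy≡fx) dup))
      }

    unshared : ¬ Any (λ y → f y ≡ f x) ys → Classes (x ∷ ys)
    unshared nodup = record
      { reps = x ∷ reps ; singles = x ∷ singles
      ; reps⊆ = reps⊆x∷ys
      ; singles⊆reps = here refl ∷ All.map there singles⊆reps
      ; reps-distinct = reps-distinct′
      ; singles-distinct = x-distinct singles-differ ∷ singles-distinct
      ; reps-cover = cover
      ; singles-alone = x-alone ∷ alone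
      ; count = subst (2 * suc (length reps) ≤_) (sym (+-suc (suc (length ys)) (length singles)))
                      (2*suc-≤-suc+ count (s≤s (length-filter (differs? x) ys)))
      }
      where
      x-alone : ∀ {z} → z ∈ x ∷ ys → f z ≡ f x → z ≡ x
      x-alone (here refl)  _     = refl
      x-alone (there z∈ys) fz≡fx = contradiction (lose z∈ys fz≡fx) nodup

    extend : Classes (x ∷ ys)
    extend with any? (λ y → f y ≟ f x) ys
    ... | yes dup  = shared dup
    ... | no nodup = unshared nodup

  classes : ∀ xs → Classes xs
  classes xs = classes≤ xs ≤-refl
    where
    classes≤ : ∀ {k} xs → length xs ≤ k → Classes xs
    classes≤ []       _ = record
      { reps = [] ; singles = [] ; reps⊆ = [] ; singles⊆reps = [] ; reps-distinct = []
      ; singles-distinct = [] ; reps-cover = λ () ; singles-alone = [] ; count = z≤n }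
    classes≤ {suc k} (x ∷ ys) (s≤s |ys|≤k) =
      Extend.extend x ys (classes≤ (filter (differs? x) ys) (≤-trans (length-filter (differs? x) ys) |ys|≤k))

linIndep⇒≤-length : {B : Vec (F2^ n) d} → LinIndep B → (R : List (Fin n)) →
                    (∀ i → ∃ λ r → r ∈ R × column B r ≡ column B i) → d ≤ length R
linIndep⇒≤-length {n} {d} {B} independent R cover = Vec-Bool-injective⇒≤ probe probe-injective
  where
  probe : F2^ d → Vec Bool (length R)
  probe c = Vec.map (λ r → ⟨ c , column B r ⟩) (fromList R)

  probe-agrees : ∀ c c′ (R : List (Fin n)) →
    Vec.map (λ r → ⟨ c , column B r ⟩) (fromList R) ≡ Vec.map (λ r → ⟨ c′ , column B r ⟩) (fromList R) →
    All (λ r → ⟨ c , column B r ⟩ ≡ ⟨ c′ , column B r ⟩) R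
  probe-agrees c c′ []      _  = []
  probe-agrees c c′ (r ∷ R) eq = ∷-injectiveˡ eq ∷ probe-agrees c c′ R (∷-injectiveʳ eq)

  probe-injective : Injective _≡_ _≡_ probe
  probe-injective {c} {c′} eq = ⊕≡𝟎⇒≡ c c′ (independent (c ⊕ c′) (Vec-ext _ 𝟎 vanishes))
    where
    vanishes : ∀ i → lookup (lincomb (c ⊕ c′) B) i ≡ lookup 𝟎 i
    vanishes i with r , r∈R , colᵣ≡colᵢ ← cover i = begin
      lookup (lincomb (c ⊕ c′) B) i                ≡⟨ lookup-lincomb (c ⊕ c′) B i ⟩
      ⟨ c ⊕ c′ , column B i ⟩                      ≡⟨ ⟨⟩-distribʳ-⊕ c c′ (column B i) ⟩
      ⟨ c , column B i ⟩ xor ⟨ c′ , column B i ⟩   ≡⟨ cong (λ f → ⟨ c , f ⟩ xor ⟨ c′ , f ⟩) (sym colᵣ≡colᵢ) ⟩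
      ⟨ c , column B r ⟩ xor ⟨ c′ , column B r ⟩   ≡⟨ cong (_xor ⟨ c′ , column B r ⟩) (All.lookup (probe-agrees c c′ R eq) r∈R) ⟩
      ⟨ c′ , column B r ⟩ xor ⟨ c′ , column B r ⟩  ≡⟨ xor-same ⟨ c′ , column B r ⟩ ⟩
      false                                        ≡⟨ sym (lookup-replicate i false) ⟩
      lookup 𝟎 i                                   ∎
      where open ≡-Reasoning

n∸2c≤q : ∀ {n c r q} → c ≤ n → n ∸ c ≤ r → 2 * r ≤ n + q → n ∸ 2 * c ≤ q
n∸2c≤q {n} {c} {r} {q} c≤n n∸c≤r 2r≤n+q = m≤n+o⇒m∸n≤o n (2 * c) (+-cancelˡ-≤ n n (2 * c + q) (begin
  n + n                   ≡⟨ cong (n +_) (sym (+-identityʳ n)) ⟩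
  2 * n                   ≡⟨ cong (2 *_) (sym (m∸n+n≡m c≤n)) ⟩
  2 * (n ∸ c + c)         ≡⟨ *-distribˡ-+ 2 (n ∸ c) c ⟩
  2 * (n ∸ c) + 2 * c     ≤⟨ +-monoˡ-≤ (2 * c) (*-monoʳ-≤ 2 n∸c≤r) ⟩
  2 * r + 2 * c           ≤⟨ +-monoˡ-≤ (2 * c) 2r≤n+q ⟩
  n + q + 2 * c           ≡⟨ +-assoc n q (2 * c) ⟩
  n + (q + 2 * c)         ≡⟨ cong (n +_) (+-comm q (2 * c)) ⟩
  n + (2 * c + q)         ∎))
  where open ≤-Reasoning

module UnitVectorDecomposition {V W : Subset n} {B : Vec (F2^ n) d} (B⊆V : ∀ c → lincomb c B ∈ₛ V)
  (decompose : ∀ x → ∃ λ w → ∃ λ γ → w ∈ₛ W × γ ∈⊥ V × x ≡ w ⊕ γ) where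

  w : Fin n → F2^ n
  w i = proj₁ (decompose (𝐞 i))

  w∈W : ∀ i → w i ∈ₛ W
  w∈W i = proj₁ (proj₂ (proj₂ (decompose (𝐞 i))))

  𝐞∈w+⊥ : ∀ i → 𝐞 i ∈ w i +⊥ V
  𝐞∈w+⊥ i = let (_ , γ , _ , γ⊥ , 𝐞ᵢ≡wᵢ⊕γ) = decompose (𝐞 i) in γ , γ⊥ , 𝐞ᵢ≡wᵢ⊕γ

  𝐞∈w+⊥⇒column≡ : ∀ {i j} → 𝐞 j ∈ w i +⊥ V → column B j ≡ column B i
  𝐞∈w+⊥⇒column≡ {i} 𝐞ⱼ∈ = 𝐞⊕𝐞∈⊥⇒column≡ B B⊆V (+⊥-difference 𝐞ⱼ∈ (𝐞∈w+⊥ i))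

  w≡⇒column≡ : ∀ {i j} → w i ≡ w j → column B i ≡ column B j
  w≡⇒column≡ {i} {j} wᵢ≡wⱼ = sym (𝐞∈w+⊥⇒column≡ (subst (λ u → 𝐞 j ∈ u +⊥ V) (sym wᵢ≡wⱼ) (𝐞∈w+⊥ j)))

  map-w-unique : {L : List (Fin n)} → AllPairs (λ i j → column B i ≢ column B j) L → Unique (map w L)
  map-w-unique = AllPairs.map⁺ ∘ AllPairs.map (λ colᵢ≢colⱼ → colᵢ≢colⱼ ∘ w≡⇒column≡)

  atLeastOne : ∀ i → AtLeastOneWt1 V (w i)
  atLeastOne i = 𝐞 i , 𝐞∈w+⊥ i , weight-𝐞 i

  exactlyOne : ∀ {i} → (∀ {j} → j ∈ allFin n → column B j ≡ column B i → j ≡ i) → ExactlyOneWt1 V (w i)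
  exactlyOne {i} alone = 𝐞 i , (𝐞∈w+⊥ i , weight-𝐞 i) , only-𝐞ᵢ
    where
    only-𝐞ᵢ : ∀ y → y ∈ w i +⊥ V → weight y ≡ 1 → y ≡ 𝐞 i
    only-𝐞ᵢ y y∈ wt with j , refl ← weight≡1⇒𝐞 y wt = cong 𝐞 (alone (∈-allFin j) (𝐞∈w+⊥⇒column≡ y∈))

claim4p1 : (n C : ℕ) → (V W : Subset n) → C ≤ n → HasDim V (n ∸ C) →
    IsSubspace W → DirectSumPerp W V →
    Σ (List (F2^ n)) λ S →
      (Unique S × All (λ u → u ∈ₛ W) S × n ∸ C ≤ length S × All (AtLeastOneWt1 V) S)
      × Σ (List (F2^ n)) λ S₁ →
          Unique S₁ × All (λ u → u ∈ S) S₁ × n ∸ 2 * C ≤ length S₁ × All (ExactlyOneWt1 V) S₁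
claim4p1 n C V W C≤n (_ , B , independent , _ , B⊆V) _ (_ , decompose) =
  map w reps
  , (map-w-unique reps-distinct , All.map⁺ (All.tabulate λ _ → w∈W _) , |S| , All.map⁺ (All.tabulate λ _ → atLeastOne _))
  , map w singles
  , map-w-unique singles-distinct , All.map⁺ (All.map (∈-map⁺ w) singles⊆reps) , |S₁| , All.map⁺ (All.map exactlyOne singles-alone)
  where
  open UnitVectorDecomposition B⊆V decompose
  open Classes (classes (≡-dec Data.Bool._≟_) (column B) (allFin n))

  |reps| : n ∸ C ≤ length reps
  |reps| = linIndep⇒≤-length independent reps (λ i → reps-cover (∈-allFin i))

  |S| : n ∸ C ≤ length (map w reps)
  |S| = subst (n ∸ C ≤_) (sym (length-map w reps)) |reps|

  |S₁| : n ∸ 2 * C ≤ length (map w singles)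
  |S₁| = subst (n ∸ 2 * C ≤_) (sym (length-map w singles))
    (n∸2c≤q C≤n |reps| (subst (λ k → 2 * length reps ≤ k + length singles) (length-tabulate id) count))
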